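{- Let $Y$ be a Young diagram with row lengths $a_1\ge\cdots\ge a_m\ge 0$, let $P$ be a 2-cover of $H(Y)$ and let $Q=P\cap(C\times S)$. Then \[|P|\ge |Q|+\sum_{i=1}^m\nu(a_i,Q).\]
   Context: $H(Y)$ is the tripartite 3-uniform hypergraph with sides $R=\{r_1,\dots,r_m\}$, $C=\{c_1,\dots,c_{a_1}\}$, $S=\{s_1,\dots,s_{a_1}\}$ and edge set $\bigcup_{i=1}^m\{\{r_i,c_j,s_k\}: 1\le j,k\le a_i\}$. For disjoint sets $A,B$, $A\times B=\{\{a,b\}: a\in A,b\in B\}$. A 2-cover of $H(Y)$ is a set $P\subseteq (R\times C)\cup(R\times S)\cup(C\times S)$ such that every edge of $H(Y)$ contains at least one pair of $P$. For an integer $\ell\ge0$ and $Q\subseteq C\times S$, $\nu(\ell,Q)$ is the matching number of the bipartite graph on $\{c_1,\dots,c_\ell\}\cup\{s_1,\dots,s_\ell\}$ with edge set $\{\{c_j,s_k\}: j,k\le\ell\}\setminus Q$. -}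

module Defs where

open import Data.Nat using (ℕ; zero; suc; _≤_; _<_)
open import Data.Fin using (Fin; toℕ) renaming (zero to fzero; _≤_ to _≤ᶠ_)
open import Data.List using (List; length; map; allFin; filter)
open import Data.Nat.ListAction using (sum)
open import Data.List.Membership.Propositional using (_∈_)
open import Data.List.Relation.Unary.All using (All)
open import Data.List.Relation.Unary.Unique.Propositional using (Unique)
open import Data.Product using (_×_; _,_; proj₁; proj₂; Σ; ∃)
open import Data.Sum using (_⊎_)
open import Relation.Nullary using (¬_; Dec; yes; no)
open import Relation.Unary using (Pred; Decidable)
open import Level using (0ℓ)

-- A Young diagram with m rows: row lengths a 0 ≥ a 1 ≥ ... ≥ a (m-1) ≥ 0
-- (rows are indexed by Fin m; row i+1 of the paper is index i here).
IsYoung : (m : ℕ) → (Fin m → ℕ) → Set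
IsYoung m a = ∀ (i j : Fin m) → i ≤ᶠ j → a j ≤ a i

-- a₁, the length of the first row (0 if there are no rows); |C| = |S| = a₁.
firstRow : (m : ℕ) → (Fin m → ℕ) → ℕ
firstRow zero    a = 0
firstRow (suc m) a = a fzero

-- Pairs of vertices from different sides of H(Y):
-- R = Fin m, C = Fin n, S = Fin n (n = a₁).
data VPair (m n : ℕ) : Set where
  rc : Fin m → Fin n → VPair m n
  rs : Fin m → Fin n → VPair m n
  cs : Fin n → Fin n → VPair m n

-- A finite set of pairs, given as a duplicate-free list; its size is its length.
-- P is a 2-cover of H(Y): every edge {r_i, c_j, s_k} (j, k < a_i) contains a pair of P.
Is2Cover : (m : ℕ) (a : Fin m → ℕ) → List (VPair m (firstRow m a)) → Set
Is2Cover m a P =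
  Unique P ×
  (∀ (i : Fin m) (j k : Fin (firstRow m a)) → toℕ j < a i → toℕ k < a i →
     (rc i j ∈ P) ⊎ (rs i k ∈ P) ⊎ (cs j k ∈ P))

isCS : ∀ {m n} → VPair m n → Set
isCS (rc _ _) = Data.Empty.⊥ where import Data.Empty
isCS (rs _ _) = Data.Empty.⊥ where import Data.Empty
isCS (cs _ _) = Data.Unit.⊤ where import Data.Unit

isCS? : ∀ {m n} → Decidable (isCS {m} {n})
isCS? (rc _ _) = no (λ ())
isCS? (rs _ _) = no (λ ())
isCS? (cs _ _) = yes _

csPart : ∀ {m n} → List (VPair m n) → List (VPair m n)
csPart P = filter isCS? P

-- A matching of the bipartite graph on {c_1..c_ℓ} ∪ {s_1..s_ℓ} with edge set
-- {{c_j,s_k} : j,k ≤ ℓ} \ Q : a list of edges (j , k) (0-indexed, j,k < ℓ), none in Q,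
-- with pairwise distinct C-endpoints and pairwise distinct S-endpoints.
IsMatching : ∀ {m n} → ℕ → List (VPair m n) → List (Fin n × Fin n) → Set
IsMatching {m} {n} ℓ Q M =
  All (λ e → toℕ (proj₁ e) < ℓ × toℕ (proj₂ e) < ℓ × ¬ (cs (proj₁ e) (proj₂ e) ∈ Q)) M ×
  Unique (map proj₁ M) × Unique (map proj₂ M)

IsMatchingNumber : ∀ {m n} → ℕ → List (VPair m n) → ℕ → Set
IsMatchingNumber {m} {n} ℓ Q k =
  (Σ (List (Fin n × Fin n)) λ M → IsMatching {m} ℓ Q M × length M ≡ k) ×
  (∀ M → IsMatching {m} ℓ Q M → length M ≤ k)
  where open import Relation.Binary.PropositionalEquality using (_≡_)

ΣFin : (m : ℕ) → (Fin m → ℕ) → ℕ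
ΣFin m f = sum (map f (allFin m))

{-# OPTIONS --safe #-}
-- Take a maximum matching M_i of the bipartite graph of row i. Every edge {c_j, s_k}
-- of M_i avoids Q, so the edge {r_i, c_j, s_k} of H(Y) is covered by {r_i, c_j} or
-- {r_i, s_k} in P. Because M_i is a matching these ν(a_i, Q) pairs are distinct; pairs
-- from different rows contain different r_i, and none lies in C × S. So P contains Q
-- and, disjointly, ν(a_i, Q) further pairs for every row i.
module Submission where

open import Defs
open import Data.Nat using (ℕ; suc; _≤_; _+_; s≤s; z≤n)
open import Data.Nat.Properties using (module ≤-Reasoning)
open import Data.Nat.ListAction using (sum)
open import Data.Fin using (Fin)
open import Data.List using (List; []; _∷_; _++_; length; map; concat; concatMap; allFin)
open import Data.List.Properties using (length-++; length-removeAt′; map-cong; map-∘)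
open import Data.List.Membership.Propositional using (_∈_; _∉_)
open import Data.List.Membership.Propositional.Properties using (∈-filter⁺; ∈-filter⁻)
open import Data.List.Relation.Unary.Any using (here; there; _─_)
open import Data.List.Relation.Unary.All as All using (All; []; _∷_)
open import Data.List.Relation.Unary.All.Properties using (All¬⇒¬Any; ++⁺; concat⁺; map⁺; tabulate⁺)
open import Data.List.Relation.Unary.AllPairs as AllPairs using ([]; _∷_)
import Data.List.Relation.Unary.AllPairs.Properties as AllPairs
open import Data.List.Relation.Unary.Unique.Propositional using (Unique)
import Data.List.Relation.Unary.Unique.Propositional.Properties as Unique
open import Data.List.Relation.Binary.Disjoint.Propositional using (Disjoint)
open import Data.Product using (_×_; _,_; proj₁; proj₂)
open import Data.Sum using (inj₁; inj₂)
open import Data.Unit using (tt)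
open import Function using (_∘_)
open import Relation.Nullary using (¬_; contradiction)
open import Relation.Binary.PropositionalEquality using (_≡_; _≢_; refl; sym; cong; module ≡-Reasoning)

module _ {A : Set} where

  ∈-─⁺ : ∀ {x y : A} {xs} (x∈xs : x ∈ xs) → y ∈ xs → y ≢ x → y ∈ (xs ─ x∈xs)
  ∈-─⁺ (here refl) (here refl) y≢x = contradiction refl y≢x
  ∈-─⁺ (here refl) (there y∈xs) _  = y∈xs
  ∈-─⁺ (there _)   (here refl)  _  = here refl
  ∈-─⁺ (there x∈xs) (there y∈xs) y≢x = there (∈-─⁺ x∈xs y∈xs y≢x)

  Unique-⊆⇒length≤ : ∀ {xs ys : List A} → Unique xs → All (_∈ ys) xs → length xs ≤ length ys
  Unique-⊆⇒length≤ {[]}     _               _              = z≤n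
  Unique-⊆⇒length≤ {x ∷ xs} {ys} (x∉xs ∷ xs!) (x∈ys ∷ xs⊆ys) = begin
    suc (length xs)            ≤⟨ s≤s (Unique-⊆⇒length≤ xs! xs⊆ys─x) ⟩
    suc (length (ys ─ x∈ys))   ≡⟨ sym (length-removeAt′ ys _) ⟩
    length ys                  ∎
    where
    open ≤-Reasoning
    xs⊆ys─x : All (_∈ (ys ─ x∈ys)) xs
    xs⊆ys─x = All.zipWith (λ (x≢y , y∈ys) → ∈-─⁺ x∈ys y∈ys (x≢y ∘ sym)) (x∉xs , xs⊆ys)

  length-concat : (xss : List (List A)) → length (concat xss) ≡ sum (map length xss)
  length-concat []         = refl
  length-concat (xs ∷ xss) = begin
    length (xs ++ concat xss)          ≡⟨ length-++ xs ⟩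
    length xs + length (concat xss)    ≡⟨ cong (length xs +_) (length-concat xss) ⟩
    length xs + sum (map length xss)   ∎
    where open ≡-Reasoning

module _ {m n : ℕ} where

  data MatchedEndpoint (i : Fin m) (M : List (Fin n × Fin n)) : VPair m n → Set where
    rc∈ : ∀ {j} → j ∈ map proj₁ M → MatchedEndpoint i M (rc i j)
    rs∈ : ∀ {k} → k ∈ map proj₂ M → MatchedEndpoint i M (rs i k)

  MatchedEndpoint-row : ∀ {i i′ M M′ x} → MatchedEndpoint i M x → MatchedEndpoint i′ M′ x → i ≡ i′
  MatchedEndpoint-row (rc∈ _) (rc∈ _) = refl
  MatchedEndpoint-row (rs∈ _) (rs∈ _) = refl

  MatchedEndpoint-∷ : ∀ {i M e x} → MatchedEndpoint i M x → MatchedEndpoint i (e ∷ M) x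
  MatchedEndpoint-∷ (rc∈ j∈) = rc∈ (there j∈)
  MatchedEndpoint-∷ (rs∈ k∈) = rs∈ (there k∈)

  rc-∉-MatchedEndpoint : ∀ {i M j x} → j ∉ map proj₁ M → MatchedEndpoint i M x → rc i j ≢ x
  rc-∉-MatchedEndpoint j∉ (rc∈ j∈) refl = j∉ j∈

  rs-∉-MatchedEndpoint : ∀ {i M k x} → k ∉ map proj₂ M → MatchedEndpoint i M x → rs i k ≢ x
  rs-∉-MatchedEndpoint k∉ (rs∈ k∈) refl = k∉ k∈

  MatchedEndpoint⇒¬isCS : ∀ {i M x} → MatchedEndpoint i M x → ¬ isCS x
  MatchedEndpoint⇒¬isCS (rc∈ _) ()
  MatchedEndpoint⇒¬isCS (rs∈ _) ()

module _ {m : ℕ} {a : Fin m → ℕ} (P : List (VPair m (firstRow m a))) (cover : Is2Cover m a P) where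

  private
    n = firstRow m a

  record RowCover (i : Fin m) (M : List (Fin n × Fin n)) : Set where
    field
      pairs     : List (VPair m n)
      length≡   : length pairs ≡ length M
      pairs⊆P   : All (_∈ P) pairs
      unique    : Unique pairs
      endpoints : All (MatchedEndpoint i M) pairs
  open RowCover

  RowCover-∷ : ∀ {i M e x} → (R : RowCover i M) → x ∈ P → MatchedEndpoint i (e ∷ M) x →
               All (x ≢_) (pairs R) → RowCover i (e ∷ M)
  RowCover-∷ R x∈P x-end x-fresh = record
    { pairs     = _ ∷ pairs R
    ; length≡   = cong suc (length≡ R)
    ; pairs⊆P   = x∈P ∷ pairs⊆P R
    ; unique    = x-fresh ∷ unique R
    ; endpoints = x-end ∷ All.map MatchedEndpoint-∷ (endpoints R)
    }

  matchingRowCover : ∀ i {M} → IsMatching {m} (a i) (csPart P) M → RowCover i M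
  matchingRowCover i {[]} _ = record
    { pairs = [] ; length≡ = refl ; pairs⊆P = [] ; unique = [] ; endpoints = [] }
  matchingRowCover i {(j , k) ∷ M} ((j<aᵢ , k<aᵢ , jk∉Q) ∷ M-avoids , j∉ ∷ M₁! , k∉ ∷ M₂!)
    with R ← matchingRowCover i (M-avoids , M₁! , M₂!)
       | proj₂ cover i j k j<aᵢ k<aᵢ
  ... | inj₁ rc∈P        = RowCover-∷ R rc∈P (rc∈ (here refl))
                             (All.map (rc-∉-MatchedEndpoint (All¬⇒¬Any j∉)) (endpoints R))
  ... | inj₂ (inj₁ rs∈P) = RowCover-∷ R rs∈P (rs∈ (here refl))
                             (All.map (rs-∉-MatchedEndpoint (All¬⇒¬Any k∉)) (endpoints R))
  ... | inj₂ (inj₂ cs∈P) = contradiction (∈-filter⁺ isCS? cs∈P tt) jk∉Q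

  csPart+matchings≤ : (M : Fin m → List (Fin n × Fin n)) →
                      (∀ i → IsMatching {m} (a i) (csPart P) (M i)) →
                      length (csPart P) + sum (map (length ∘ M) (allFin m)) ≤ length P
  csPart+matchings≤ M M-matching = begin
    length (csPart P) + sum (map (length ∘ M) (allFin m)) ≡⟨ cong (length (csPart P) +_) rows-length ⟩
    length (csPart P) + length rows                       ≡⟨ length-++ (csPart P) ⟨
    length (csPart P ++ rows)                             ≤⟨ Unique-⊆⇒length≤ all-unique all⊆P ⟩
    length P                                              ∎
    where
    open ≤-Reasoning
    rowCover : ∀ i → RowCover i (M i)
    rowCover i = matchingRowCover i (M-matching i)

    row : Fin m → List (VPair m n)
    row i = pairs (rowCover i)

    rows : List (VPair m n)
    rows = concatMap row (allFin m)

    All-rows : ∀ {Q : List (VPair m n) → Set} → (∀ i → Q (row i)) → All Q (map row (allFin m))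
    All-rows Q-row = map⁺ (tabulate⁺ Q-row)

    rows-length : sum (map (length ∘ M) (allFin m)) ≡ length rows
    rows-length = begin-equality
      sum (map (length ∘ M) (allFin m))          ≡⟨ cong sum (map-cong (λ i → length≡ (rowCover i)) (allFin m)) ⟨
      sum (map (length ∘ row) (allFin m))        ≡⟨ cong sum (map-∘ (allFin m)) ⟩
      sum (map length (map row (allFin m)))      ≡⟨ length-concat (map row (allFin m)) ⟨
      length rows                                ∎

    rows-disjoint : ∀ {i i′} → i ≢ i′ → Disjoint (row i) (row i′)
    rows-disjoint {i} {i′} i≢i′ (x∈row , x∈row′) = i≢i′ (MatchedEndpoint-row
      (All.lookup (endpoints (rowCover i)) x∈row)
      (All.lookup (endpoints (rowCover i′)) x∈row′))

    rows-unique : Unique rows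
    rows-unique = Unique.concat⁺
      (All-rows (λ i → unique (rowCover i)))
      (AllPairs.map⁺ (AllPairs.map rows-disjoint (Unique.allFin⁺ m)))

    rows-¬isCS : All (¬_ ∘ isCS) rows
    rows-¬isCS = concat⁺ (All-rows (λ i →
      All.map MatchedEndpoint⇒¬isCS (endpoints (rowCover i))))

    all-unique : Unique (csPart P ++ rows)
    all-unique = Unique.++⁺ (Unique.filter⁺ isCS? (proj₁ cover)) rows-unique
      (λ (x∈Q , x∈rows) → All.lookup rows-¬isCS x∈rows (proj₂ (∈-filter⁻ isCS? {xs = P} x∈Q)))

    all⊆P : All (_∈ P) (csPart P ++ rows)
    all⊆P = ++⁺ (All.tabulate (proj₁ ∘ ∈-filter⁻ isCS? {xs = P}))
                (concat⁺ (All-rows (λ i → pairs⊆P (rowCover i))))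

-- The bound holds for any row lengths.
corollary2p8 : (m : ℕ) (a : Fin m → ℕ) → IsYoung m a →
    (P : List (VPair m (firstRow m a))) → Is2Cover m a P →
    (ν : Fin m → ℕ) → (∀ i → IsMatchingNumber (a i) (csPart P) (ν i)) →
    length (csPart P) + ΣFin m ν ≤ length P
corollary2p8 m a _ P cover ν ν-matchingNumber = begin
  length (csPart P) + ΣFin m ν                              ≡⟨ cong (λ ls → length (csPart P) + sum ls)
                                                                    (map-cong length-M (allFin m)) ⟨
  length (csPart P) + sum (map (length ∘ M) (allFin m))     ≤⟨ csPart+matchings≤ P cover M M-matching ⟩
  length P                                                  ∎
  where
  open ≤-Reasoning
  M : Fin m → List (Fin (firstRow m a) × Fin (firstRow m a))
  M i = proj₁ (proj₁ (ν-matchingNumber i))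

  M-matching : ∀ i → IsMatching {m} (a i) (csPart P) (M i)
  M-matching i = proj₁ (proj₂ (proj₁ (ν-matchingNumber i)))

  length-M : ∀ i → length (M i) ≡ ν i
  length-M i = proj₂ (proj₂ (proj₁ (ν-matchingNumber i)))
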